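{- Let $\{D_I\}_{I\in\binom{[n]}{2}}$ be a family of positive real numbers which is bigraphlike on $X,Y\subseteq[n]$. The family is co-bigraphlike on $X$ and $Y$ if and only if $D_{i,j}$ is indecomposable for all $i\in X$, $j\in Y$.
   Context: Write $D_{i,j}=D_{\{i,j\}}$. $D_{i,j}$ is indecomposable if $D_{i,j}<D_{i,z}+D_{z,j}$ for all $z\in[n]\setminus\{i,j\}$. A graph $B$ (finite, simple, connected) is bipartite on $X,Y$ if $X\cap Y=\emptyset$, $X\cup Y=V(B)$ and every edge joins $X$ to $Y$; it is complete bipartite if moreover every pair $x\in X,y\in Y$ is joined by an edge. A positive-weighted graph $\mathcal G=(G,w)$ has $w:E(G)\to\mathbb R_{>0}$, and $D_{i,j}(\mathcal G)$ is the minimum total weight of a path from $i$ to $j$. An edge $e$ is useful if there exist vertices $a,b$ such that every minimum-weight path from $a$ to $b$ contains $e$; $\mathcal G$ is pruned if all edges are useful. The family is bigraphlike on $X,Y$ if there is a positive-weighted bipartite graph $\mathcal B$ on $X,Y$ with $V(B)=[n]$ and $D_{i,j}(\mathcal B)=D_{i,j}$ for all distinct $i,j$; it is co-bigraphlike on $X,Y$ if there is such a $\mathcal B$ which is moreover a pruned complete bipartite graph on $X,Y$. -}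

module Defs where

open import Data.Nat using (ℕ)
open import Data.Fin using (Fin)
open import Data.Fin.Subset using (Subset; _∈_)
open import Data.Bool using (Bool; true; false; T)
open import Data.List using (List; []; _∷_)
open import Data.List.Relation.Unary.Unique.Propositional using (Unique)
open import Data.Product using (Σ; ∃; _×_; _,_)
open import Data.Sum using (_⊎_)
open import Data.Empty using (⊥)
open import Relation.Nullary using (¬_)
open import Relation.Binary.PropositionalEquality using (_≡_; _≢_)
open import Relation.Binary.Structures using (IsStrictTotalOrder)
open import Algebra.Structures using (IsCommutativeRing)

-- Any model is
-- (classically) isomorphic to ℝ.

record RealField : Set₁ where
  infixl 6 _+_
  infixl 7 _*_
  infix 4 _<_ _≤_
  field
    Carrier : Set
    _+_ _*_ : Carrier → Carrier → Carrier
    -_      : Carrier → Carrier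
    0# 1#   : Carrier
    _<_     : Carrier → Carrier → Set
    isCommutativeRing : IsCommutativeRing _≡_ _+_ _*_ -_ 0# 1#
    isStrictTotalOrder : IsStrictTotalOrder _≡_ _<_
    0<1      : 0# < 1#
    +-mono-< : ∀ {x y} z → x < y → x + z < y + z
    *-pos    : ∀ {x y} → 0# < x → 0# < y → 0# < x * y
    inverse  : ∀ x → x ≢ 0# → Σ Carrier (λ y → x * y ≡ 1#)

  _≤_ : Carrier → Carrier → Set
  x ≤ y = (x < y) ⊎ (x ≡ y)

  IsUpperBound : (Carrier → Set) → Carrier → Set
  IsUpperBound P u = ∀ x → P x → x ≤ u

  field
    lub : (P : Carrier → Set) → Σ Carrier P → Σ Carrier (IsUpperBound P) →
          Σ Carrier (λ s → IsUpperBound P s × (∀ u → IsUpperBound P u → s ≤ u))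

module Graphs (R : RealField) where
  open RealField R

  -- A family {D_I} indexed by 2-subsets, represented as a symmetric
  -- function on Fin n × Fin n whose diagonal values are irrelevant.
  record Family (n : ℕ) : Set where
    field
      D     : Fin n → Fin n → Carrier
      D-sym : ∀ i j → D i j ≡ D j i
      D-pos : ∀ i j → i ≢ j → 0# < D i j

  record WGraph (n : ℕ) : Set where
    field
      adj        : Fin n → Fin n → Bool
      adj-sym    : ∀ i j → adj i j ≡ adj j i
      adj-irrefl : ∀ i → adj i i ≡ false
      w          : Fin n → Fin n → Carrier
      w-sym      : ∀ i j → w i j ≡ w j i
      w-pos      : ∀ i j → T (adj i j) → 0# < w i j

  module _ {n : ℕ} (G : WGraph n) where
    open WGraph G

    data Walk : Fin n → Fin n → Set where
      []   : ∀ {i} → Walk i i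
      step : ∀ {i k} (j : Fin n) → T (adj i j) → Walk j k → Walk i k

    vertices : ∀ {i j} → Walk i j → List (Fin n)
    vertices {i} []           = i ∷ []
    vertices {i} (step j _ p) = i ∷ vertices p

    weight : ∀ {i j} → Walk i j → Carrier
    weight []                = 0#
    weight {i} (step j _ p)  = w i j + weight p

    Path : Fin n → Fin n → Set
    Path a b = Σ (Walk a b) (λ p → Unique (vertices p))

    pweight : ∀ {a b} → Path a b → Carrier
    pweight (p , _) = weight p

    usesEdge : ∀ {i j} → Fin n → Fin n → Walk i j → Set
    usesEdge u v []               = ⊥
    usesEdge u v (step {i} j _ p) = ((i ≡ u × j ≡ v) ⊎ (i ≡ v × j ≡ u)) ⊎ usesEdge u v p

    Connected : Set
    Connected = ∀ i j → Path i j

    IsMinPath : ∀ {a b} → Path a b → Set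
    IsMinPath {a} {b} p = ∀ (q : Path a b) → pweight p ≤ pweight q

    IsDist : Fin n → Fin n → Carrier → Set
    IsDist a b d = Σ (Path a b) (λ p → IsMinPath p × pweight p ≡ d)

    Useful : Fin n → Fin n → Set
    Useful u v = Σ (Fin n) λ a → Σ (Fin n) λ b →
                   ∀ (p : Path a b) → IsMinPath p → usesEdge u v (Σ.proj₁ p)

    Pruned : Set
    Pruned = ∀ u v → T (adj u v) → Useful u v

    IsBipartite : Subset n → Subset n → Set
    IsBipartite X Y =
      (∀ i → i ∈ X → i ∈ Y → ⊥) ×
      (∀ i → i ∈ X ⊎ i ∈ Y) ×
      (∀ u v → T (adj u v) → (u ∈ X × v ∈ Y) ⊎ (u ∈ Y × v ∈ X))

    IsCompleteBipartite : Subset n → Subset n → Set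
    IsCompleteBipartite X Y =
      IsBipartite X Y × (∀ x y → x ∈ X → y ∈ Y → T (adj x y))

    Realizes : Family n → Set
    Realizes F = ∀ i j → i ≢ j → IsDist i j (Family.D F i j)

  module _ {n : ℕ} (F : Family n) where
    open Family F

    Indecomposable : Fin n → Fin n → Set
    Indecomposable i j = ∀ z → z ≢ i → z ≢ j → D i j < D i z + D z j

    Bigraphlike : Subset n → Subset n → Set
    Bigraphlike X Y = Σ (WGraph n) λ B →
      Connected B × IsBipartite B X Y × Realizes B F

    CoBigraphlike : Subset n → Subset n → Set
    CoBigraphlike X Y = Σ (WGraph n) λ B →
      Connected B × IsCompleteBipartite B X Y × Pruned B × Realizes B F

-- Forward: if D_{ij} = D_{iz} + D_{zj} for an edge ij of a realizing graph, gluing shortest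
-- paths i → z → j gives a detour strictly lighter on each half than the edge itself, so
-- every walk can be rerouted around ij at no cost and ij is not useful.  Backward: put the
-- weight D_{xy} on every pair x ∈ X, y ∈ Y.  The edges of the given bipartite realization
-- only get lighter, while the triangle inequality keeps every walk at least as heavy as D,
-- so this complete bipartite graph still realizes D; an edge xy is useful because any
-- other route through some z costs at least D_{xz} + D_{zy} > D_{xy}.
module Submission where

open import Defs
open import Data.Nat using (ℕ)
open import Data.Fin using (Fin; _≟_)
open import Data.Fin.Subset using (Subset; _∈_)
open import Data.Fin.Subset.Properties using (_∈?_)
open import Data.Bool using (T)
open import Data.List using (_∷_)
open import Data.List.Relation.Unary.Any using (here; there)
open import Data.List.Relation.Unary.All.Properties using (¬Any⇒All¬)
open import Data.List.Relation.Unary.All using ([]; _∷_)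
open import Data.List.Relation.Unary.AllPairs using ([]; _∷_)
open import Data.List.Relation.Unary.Unique.Propositional using (Unique)
open import Data.List.Membership.Propositional using () renaming (_∈_ to _∈ᴸ_)
import Data.List.Membership.DecPropositional as DecMembership
open import Data.Product using (Σ; _×_; _,_; proj₁; swap)
open import Data.Sum using (_⊎_; inj₁; inj₂; [_,_]; map₁)
open import Data.Empty using (⊥; ⊥-elim)
open import Function.Base using (_∘_; id)
open import Function.Bundles using (_⇔_; mk⇔)
open import Relation.Nullary using (¬_; Dec; yes; no)
open import Relation.Nullary.Decidable
  using (_×-dec_; _⊎-dec_; isYes; toWitness; fromWitness; isYes≗does; does-⇔; dec-false)
open import Relation.Binary.PropositionalEquality
  using (_≡_; _≢_; refl; sym; trans; cong; cong₂; subst; subst₂)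
open import Relation.Binary.Bundles using (StrictTotalOrder; DecTotalOrder)
open import Relation.Binary.Definitions using (tri<; tri≈; tri>)
import Relation.Binary.Properties.StrictTotalOrder as StrictTotalOrderProperties
open import Algebra.Structures using (IsCommutativeRing)

module ShortestPathMetrics (R : RealField) where
  open RealField R
  open Graphs R
  open IsCommutativeRing isCommutativeRing using (+-comm; +-identityˡ; +-identityʳ; +-assoc)

  strictTotalOrder : StrictTotalOrder _ _ _
  strictTotalOrder = record { isStrictTotalOrder = isStrictTotalOrder }

  open StrictTotalOrder strictTotalOrder using (compare; strictPartialOrder)
  open DecTotalOrder (StrictTotalOrderProperties.decTotalOrder strictTotalOrder)
    using () renaming (refl to ≤-refl; reflexive to ≤-reflexive; trans to ≤-trans; antisym to ≤-antisym)
  open import Relation.Binary.Reasoning.StrictPartialOrder strictPartialOrder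

  <⇒≱ : ∀ {x y} → x < y → ¬ (y ≤ x)
  <⇒≱ {x} x<y y≤x = begin-contradiction x <⟨ x<y ⟩ _ ≤⟨ y≤x ⟩ x ∎

  +-monoˡ-≤ : ∀ {x y} z → x ≤ y → x + z ≤ y + z
  +-monoˡ-≤ z (inj₁ x<y) = inj₁ (+-mono-< z x<y)
  +-monoˡ-≤ z (inj₂ refl) = ≤-refl

  +-monoʳ-≤ : ∀ {x y} z → x ≤ y → z + x ≤ z + y
  +-monoʳ-≤ {x} {y} z x≤y = subst₂ _≤_ (+-comm x z) (+-comm y z) (+-monoˡ-≤ z x≤y)

  +-monoʳ-< : ∀ {x y} z → x < y → z + x < z + y
  +-monoʳ-< {x} {y} z x<y = subst₂ _<_ (+-comm x z) (+-comm y z) (+-mono-< z x<y)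

  +-mono-≤ : ∀ {x y u v} → x ≤ y → u ≤ v → x + u ≤ y + v
  +-mono-≤ {y = y} {u} x≤y u≤v = ≤-trans (+-monoˡ-≤ u x≤y) (+-monoʳ-≤ y u≤v)

  x≤x+y : ∀ {x y} → 0# ≤ y → x ≤ x + y
  x≤x+y {x} 0≤y = subst₂ _≤_ (+-identityʳ x) refl (+-monoʳ-≤ x 0≤y)

  x≤y+x : ∀ {x y} → 0# ≤ y → x ≤ y + x
  x≤y+x {x} {y} 0≤y = subst₂ _≤_ refl (+-comm x y) (x≤x+y 0≤y)

  x<x+y : ∀ {x y} → 0# < y → x < x + y
  x<x+y {x} 0<y = subst₂ _<_ (+-identityʳ x) refl (+-monoʳ-< x 0<y)

  x<y+x : ∀ {x y} → 0# < y → x < y + x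
  x<y+x {x} {y} 0<y = subst₂ _<_ refl (+-comm x y) (x<x+y 0<y)

  +-nonneg : ∀ {x y} → 0# ≤ x → 0# ≤ y → 0# ≤ x + y
  +-nonneg 0≤x 0≤y = ≤-trans 0≤x (x≤x+y 0≤y)

  module Walks {n : ℕ} (G : WGraph n) where
    open WGraph G
    open DecMembership (_≟_ {n}) using () renaming (_∈?_ to _∈ᴸ?_)

    adj⇒≢ : ∀ {i j} → T (adj i j) → i ≢ j
    adj⇒≢ {i} e refl rewrite adj-irrefl i = e

    infixr 5 _++ʷ_
    _++ʷ_ : ∀ {a b c} → Walk G a b → Walk G b c → Walk G a c
    []           ++ʷ q = q
    step j e p   ++ʷ q = step j e (p ++ʷ q)

    weight-++ : ∀ {a b c} (p : Walk G a b) (q : Walk G b c) →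
                weight G (p ++ʷ q) ≡ weight G p + weight G q
    weight-++ []               q = sym (+-identityˡ _)
    weight-++ {a} (step j e p) q rewrite weight-++ p q = sym (+-assoc (w a j) (weight G p) (weight G q))

    weight-nonneg : ∀ {a b} (p : Walk G a b) → 0# ≤ weight G p
    weight-nonneg []               = ≤-refl
    weight-nonneg {a} (step j e p) = +-nonneg (inj₁ (w-pos a j e)) (weight-nonneg p)

    usesEdge-++ : ∀ {a b c i j} (p : Walk G a b) (q : Walk G b c) →
                  usesEdge G i j (p ++ʷ q) → usesEdge G i j p ⊎ usesEdge G i j q
    usesEdge-++ []           q uses          = inj₂ uses
    usesEdge-++ (step j e p) q (inj₁ same)   = inj₁ (inj₁ same)
    usesEdge-++ (step j e p) q (inj₂ uses)   = map₁ inj₂ (usesEdge-++ p q uses)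

    w≤weight : ∀ {a b i j} (p : Walk G a b) → usesEdge G i j p → w i j ≤ weight G p
    w≤weight (step k e p) (inj₁ (inj₁ (refl , refl))) = x≤x+y (weight-nonneg p)
    w≤weight {a} (step k e p) (inj₁ (inj₂ (refl , refl))) =
      ≤-trans (≤-reflexive (w-sym k a)) (x≤x+y (weight-nonneg p))
    w≤weight {a} (step k e p) (inj₂ uses) =
      ≤-trans (w≤weight p uses) (x≤y+x (inj₁ (w-pos a k e)))

    lighter⇒¬usesEdge : ∀ {a b i j} (p : Walk G a b) → weight G p < w i j → ¬ usesEdge G i j p
    lighter⇒¬usesEdge p p<w uses = <⇒≱ p<w (w≤weight p uses)

    trivialPath : ∀ {a} → Path G a a
    trivialPath = [] , [] ∷ []

    edgePath : ∀ {i j} → T (adj i j) → Path G i j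
    edgePath e = step _ e [] , (adj⇒≢ e ∷ []) ∷ [] ∷ []

    infix 4 _≼_
    record _≼_ {a b c d} (r : Walk G a b) (q : Walk G c d) : Set where
      constructor ≼-intro
      field
        weight-≤ : weight G r ≤ weight G q
        edges-⊆  : ∀ s t → usesEdge G s t r → usesEdge G s t q
    open _≼_ public

    ≼-refl : ∀ {a b} {p : Walk G a b} → p ≼ p
    ≼-refl = ≼-intro ≤-refl (λ _ _ → id)

    ≼-trans : ∀ {a b c d e f} {p : Walk G a b} {q : Walk G c d} {r : Walk G e f} →
              p ≼ q → q ≼ r → p ≼ r
    ≼-trans (≼-intro p≤q p⊆q) (≼-intro q≤r q⊆r) = ≼-intro (≤-trans p≤q q≤r) (λ s t → q⊆r s t ∘ p⊆q s t)

    ≼-step : ∀ {a b c d k} {p : Walk G a b} {q : Walk G k d} (e : T (adj c k)) →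
             p ≼ q → p ≼ step k e q
    ≼-step {c = c} {k = k} e (≼-intro p≤q p⊆q) =
      ≼-intro (≤-trans p≤q (x≤y+x (inj₁ (w-pos c k e)))) (λ s t → inj₂ ∘ p⊆q s t)

    step-≼ : ∀ {a b k} {p q : Walk G k b} (e : T (adj a k)) → p ≼ q → step k e p ≼ step k e q
    step-≼ {a} {k = k} e (≼-intro p≤q p⊆q) =
      ≼-intro (+-monoʳ-≤ (w a k) p≤q) (λ s t → [ inj₁ , inj₂ ∘ p⊆q s t ])

    suffixFrom : ∀ {i j b} (q : Walk G j b) → i ∈ᴸ vertices G q →
                 Σ (Walk G i b) λ r → r ≼ q × (Unique (vertices G q) → Unique (vertices G r))
    suffixFrom []           (here refl) = [] , ≼-refl , id
    suffixFrom (step k e q) (here refl) = step k e q , ≼-refl , id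
    suffixFrom (step k e q) (there i∈q) with suffixFrom q i∈q
    ... | r , r≼q , unique = r , ≼-step e r≼q , λ { (_ ∷ q-unique) → unique q-unique }

    shortcut : ∀ {a b} (p : Walk G a b) → Σ (Path G a b) λ q → proj₁ q ≼ p
    shortcut []               = trivialPath , ≼-refl
    shortcut {a} (step j e p) with shortcut p
    ... | (q , q-unique) , q≼p with a ∈ᴸ? vertices G q
    ... | yes a∈q = let r , r≼q , unique = suffixFrom q a∈q
                    in (r , unique q-unique) , ≼-step e (≼-trans r≼q q≼p)
    ... | no a∉q  = (step j e q , ¬Any⇒All¬ _ a∉q ∷ q-unique) , step-≼ e q≼p

    SameEdge : Fin n → Fin n → Fin n → Fin n → Set
    SameEdge i j a b = (a ≡ i × b ≡ j) ⊎ (a ≡ j × b ≡ i)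

    Bypass : Fin n → Fin n → Set
    Bypass i j = ∀ {a b} → SameEdge i j a b →
                 Σ (Walk G a b) λ d → weight G d ≤ w a b × ¬ usesEdge G i j d

    reroute : ∀ {i j} → Bypass i j → ∀ {a b} (p : Walk G a b) →
              Σ (Walk G a b) λ q → weight G q ≤ weight G p × ¬ usesEdge G i j q
    reroute bypass []                 = [] , ≤-refl , λ ()
    reroute {i} {j} bypass {a} (step k e p) with reroute bypass p
    ... | q , q≤p , q-avoids with (a ≟ i ×-dec k ≟ j) ⊎-dec (a ≟ j ×-dec k ≟ i)
    ... | yes same = let d , d≤w , d-avoids = bypass same in
      d ++ʷ q ,
      ≤-trans (≤-reflexive (weight-++ d q)) (+-mono-≤ d≤w q≤p) ,
      [ d-avoids , q-avoids ] ∘ usesEdge-++ d q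
    ... | no other = step k e q , +-monoʳ-≤ (w a k) q≤p , [ other , q-avoids ]

  module _ {n : ℕ} (F : Family n) where
    open Family F

    TriangleInequality : Set
    TriangleInequality = ∀ {i j k} → i ≢ k → i ≢ j → j ≢ k → D i k ≤ D i j + D j k

    indecomposable-sym : ∀ {i j} → Indecomposable F i j → Indecomposable F j i
    indecomposable-sym {i} {j} indec z z≢j z≢i =
      subst₂ _<_ (D-sym i j) (trans (cong₂ _+_ (D-sym i z) (D-sym z j)) (+-comm (D z i) (D j z)))
        (indec z z≢i z≢j)

  module Realized {n : ℕ} {G : WGraph n} {F : Family n} (realizes : Realizes G F) where
    open WGraph G
    open Family F
    open Walks G

    geodesic : ∀ {a b} → a ≢ b → Σ (Walk G a b) λ p → weight G p ≡ D a b
    geodesic {a} {b} a≢b = let (p , _) , _ , p≡D = realizes a b a≢b in p , p≡D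

    D≤weight : ∀ {a b} → a ≢ b → (p : Walk G a b) → D a b ≤ weight G p
    D≤weight {a} {b} a≢b p =
      let m , m-min , m≡D = realizes a b a≢b
          q , q≼p = shortcut p
      in begin D a b ≡⟨ m≡D ⟨ pweight G m ≤⟨ m-min q ⟩ weight G (proj₁ q) ≤⟨ weight-≤ q≼p ⟩ weight G p ∎

    D≤w : ∀ {i j} → T (adj i j) → D i j ≤ w i j
    D≤w {i} {j} e = begin
      D i j     ≤⟨ D≤weight (adj⇒≢ e) (proj₁ (edgePath e)) ⟩
      w i j + 0# ≡⟨ +-identityʳ (w i j) ⟩
      w i j     ∎

    triangle : TriangleInequality F
    triangle {i} {j} {k} i≢k i≢j j≢k =
      let p , p≡D = geodesic i≢j
          q , q≡D = geodesic j≢k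
      in begin
        D i k                  ≤⟨ D≤weight i≢k (p ++ʷ q) ⟩
        weight G (p ++ʷ q)     ≡⟨ weight-++ p q ⟩
        weight G p + weight G q ≡⟨ cong₂ _+_ p≡D q≡D ⟩
        D i j + D j k          ∎

    bypass⇒¬useful : ∀ {i j} → Bypass i j → ¬ Useful G i j
    bypass⇒¬useful bypass (a , b , minimal⇒uses) with a ≟ b
    ... | yes refl = minimal⇒uses trivialPath (λ q → weight-nonneg (proj₁ q))
    ... | no a≢b =
      let m , m-min , _ = realizes a b a≢b
          q , q≤m , q-avoids = reroute bypass (proj₁ m)
          r , r≼q = shortcut q
          r-min = λ s → ≤-trans (≤-trans (weight-≤ r≼q) q≤m) (m-min s)
      in q-avoids (edges-⊆ r≼q _ _ (minimal⇒uses r r-min))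

    -- Each half of the detour through z weighs less than D_{uv} ≤ w_{ij}, so neither can use ij.
    detour : ∀ {i j u v z} → z ≢ u → z ≢ v → D u z + D z v ≡ D u v → D u v ≤ w i j →
             Σ (Walk G u v) λ d → weight G d ≡ D u v × ¬ usesEdge G i j d
    detour {i} {j} {u} {v} {z} z≢u z≢v split D≤wij =
      let p , p≡D = geodesic (z≢u ∘ sym)
          q , q≡D = geodesic z≢v
          p-light = begin-strict
            weight G p     ≡⟨ p≡D ⟩
            D u z          <⟨ x<x+y (D-pos z v z≢v) ⟩
            D u z + D z v  ≡⟨ split ⟩
            D u v          ≤⟨ D≤wij ⟩
            w i j          ∎
          q-light = begin-strict
            weight G q     ≡⟨ q≡D ⟩
            D z v          <⟨ x<y+x (D-pos u z (z≢u ∘ sym)) ⟩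
            D u z + D z v  ≡⟨ split ⟩
            D u v          ≤⟨ D≤wij ⟩
            w i j          ∎
      in p ++ʷ q ,
         trans (weight-++ p q) (trans (cong₂ _+_ p≡D q≡D) split) ,
         [ lighter⇒¬usesEdge p p-light , lighter⇒¬usesEdge q q-light ] ∘ usesEdge-++ p q

    decomposable⇒bypass : ∀ {i j z} → T (adj i j) → z ≢ i → z ≢ j →
                          D i j ≡ D i z + D z j → Bypass i j
    decomposable⇒bypass e z≢i z≢j split (inj₁ (refl , refl)) =
      let d , d≡D , d-avoids = detour z≢i z≢j (sym split) (D≤w e)
      in d , ≤-trans (≤-reflexive d≡D) (D≤w e) , d-avoids
    decomposable⇒bypass {i} {j} {z} e z≢i z≢j split (inj₂ (refl , refl)) =
      let split′ = begin-equality
            D j z + D z i ≡⟨ +-comm (D j z) (D z i) ⟩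
            D z i + D j z ≡⟨ cong₂ _+_ (D-sym z i) (D-sym j z) ⟩
            D i z + D z j ≡⟨ split ⟨
            D i j         ≡⟨ D-sym i j ⟩
            D j i         ∎
          Dji≤wij = ≤-trans (≤-reflexive (D-sym j i)) (D≤w e)
          d , d≡D , d-avoids = detour z≢j z≢i split′ Dji≤wij
      in d , ≤-trans (≤-reflexive d≡D) (≤-trans Dji≤wij (≤-reflexive (w-sym i j))) , d-avoids

    pruned⇒indecomposable : Pruned G → ∀ {i j} → T (adj i j) → Indecomposable F i j
    pruned⇒indecomposable pruned {i} {j} e z z≢i z≢j with compare (D i j) (D i z + D z j)
    ... | tri< lt _ _ = lt
    ... | tri≈ _ eq _ = ⊥-elim (bypass⇒¬useful (decomposable⇒bypass e z≢i z≢j eq) (pruned i j e))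
    ... | tri> _ _ gt = ⊥-elim (<⇒≱ gt (triangle (adj⇒≢ e) (z≢i ∘ sym) z≢j))

  module Dominating {n : ℕ} {G : WGraph n} {F : Family n} (triangle : TriangleInequality F)
                    (D≤w : ∀ {a b} → T (WGraph.adj G a b) → Family.D F a b ≤ WGraph.w G a b) where
    open WGraph G
    open Family F
    open Walks G

    D≤weight : ∀ {a b} → a ≢ b → (p : Walk G a b) → D a b ≤ weight G p
    D≤weight a≢b [] = ⊥-elim (a≢b refl)
    D≤weight {a} {b} a≢b (step k e p) with k ≟ b
    ... | yes refl = ≤-trans (D≤w e) (x≤x+y (weight-nonneg p))
    ... | no k≢b = begin
      D a b              ≤⟨ triangle a≢b (adj⇒≢ e) k≢b ⟩
      D a k + D k b      ≤⟨ +-mono-≤ (D≤w e) (D≤weight k≢b p) ⟩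
      w a k + weight G p ∎

    indecomposable⇒useful : ∀ {u v} → T (adj u v) → w u v ≡ D u v → Indecomposable F u v →
                            Useful G u v
    indecomposable⇒useful {u} {v} e w≡D indec = u , v , minimal⇒uses
      where
      minimal⇒uses : (p : Path G u v) → IsMinPath G p → usesEdge G u v (proj₁ p)
      minimal⇒uses ([] , _) _ = ⊥-elim (adj⇒≢ e refl)
      minimal⇒uses (step k e′ p , _) minimal with k ≟ v
      ... | yes k≡v = inj₁ (inj₁ (refl , k≡v))
      ... | no k≢v = begin-contradiction
        w u k + weight G p  ≤⟨ minimal (edgePath e) ⟩
        w u v + 0#          ≡⟨ +-identityʳ (w u v) ⟩
        w u v               ≡⟨ w≡D ⟩
        D u v               <⟨ indec k (adj⇒≢ e′ ∘ sym) k≢v ⟩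
        D u k + D k v       ≤⟨ +-mono-≤ (D≤w e′) (D≤weight k≢v p) ⟩
        w u k + weight G p  ∎

  module Transport {n : ℕ} {G H : WGraph n}
                   (adj⇒adj : ∀ {a b} → T (WGraph.adj G a b) → T (WGraph.adj H a b))
                   (w-decreases : ∀ {a b} → T (WGraph.adj G a b) → WGraph.w H a b ≤ WGraph.w G a b) where

    transportWalk : ∀ {a b} → Walk G a b → Walk H a b
    transportWalk []           = []
    transportWalk (step j e p) = step j (adj⇒adj e) (transportWalk p)

    vertices-transport : ∀ {a b} (p : Walk G a b) → vertices H (transportWalk p) ≡ vertices G p
    vertices-transport []               = refl
    vertices-transport {a} (step j e p) = cong (a ∷_) (vertices-transport p)

    weight-transport : ∀ {a b} (p : Walk G a b) → weight H (transportWalk p) ≤ weight G p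
    weight-transport []           = ≤-refl
    weight-transport (step j e p) = +-mono-≤ (w-decreases e) (weight-transport p)

    transport : ∀ {a b} → Path G a b → Path H a b
    transport (p , unique) = transportWalk p , subst Unique (sym (vertices-transport p)) unique

  module CompleteBipartite {n : ℕ} (F : Family n) (X Y : Subset n)
                           (disjoint : ∀ i → i ∈ X → i ∈ Y → ⊥) where
    open Family F

    Crossing : Fin n → Fin n → Set
    Crossing a b = (a ∈ X × b ∈ Y) ⊎ (a ∈ Y × b ∈ X)

    crossing? : ∀ a b → Dec (Crossing a b)
    crossing? a b = (a ∈? X ×-dec b ∈? Y) ⊎-dec (a ∈? Y ×-dec b ∈? X)

    crossing-sym : ∀ {a b} → Crossing a b → Crossing b a
    crossing-sym = [ inj₂ ∘ swap , inj₁ ∘ swap ]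

    crossing-irrefl : ∀ {a} → ¬ Crossing a a
    crossing-irrefl {a} = [ (λ (a∈X , a∈Y) → disjoint a a∈X a∈Y) , (λ (a∈Y , a∈X) → disjoint a a∈X a∈Y) ]

    crossing⇒≢ : ∀ {a b} → Crossing a b → a ≢ b
    crossing⇒≢ c refl = crossing-irrefl c

    graph : WGraph n
    graph = record
      { adj        = λ a b → isYes (crossing? a b)
      ; adj-sym    = λ a b → trans (isYes≗does (crossing? a b))
                       (trans (does-⇔ (mk⇔ crossing-sym crossing-sym) (crossing? a b) (crossing? b a))
                              (sym (isYes≗does (crossing? b a))))
      ; adj-irrefl = λ a → trans (isYes≗does (crossing? a a)) (dec-false (crossing? a a) crossing-irrefl)
      ; w          = D
      ; w-sym      = D-sym
      ; w-pos      = λ a b e → D-pos a b (crossing⇒≢ (toWitness e))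
      }

    isCompleteBipartite : (∀ i → i ∈ X ⊎ i ∈ Y) → IsCompleteBipartite graph X Y
    isCompleteBipartite cover =
      (disjoint , cover , λ _ _ → toWitness) , λ _ _ x∈X y∈Y → fromWitness (inj₁ (x∈X , y∈Y))

  coBigraphlike⇒indecomposable : ∀ {n} {F : Family n} {X Y : Subset n} → CoBigraphlike F X Y →
                                 ∀ i j → i ∈ X → j ∈ Y → Indecomposable F i j
  coBigraphlike⇒indecomposable {F = F} (K , _ , (_ , complete) , pruned , realizes) i j i∈X j∈Y =
    Realized.pruned⇒indecomposable {G = K} {F = F} realizes pruned (complete i j i∈X j∈Y)

  indecomposable⇒coBigraphlike : ∀ {n} {F : Family n} {X Y : Subset n} → Bigraphlike F X Y →
                                 (∀ i j → i ∈ X → j ∈ Y → Indecomposable F i j) →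
                                 CoBigraphlike F X Y
  indecomposable⇒coBigraphlike {n} {F} {X} {Y} (B , connected , (disjoint , cover , bipartite) , realizes) indec =
    graph , (λ a b → transport (connected a b)) , isCompleteBipartite cover , pruned , realizesGraph
    where
    open Family F
    open CompleteBipartite F X Y disjoint
    open Realized {G = B} {F = F} realizes using (D≤w; triangle)
    open Dominating {G = graph} {F = F} triangle (λ _ → ≤-refl) using (D≤weight; indecomposable⇒useful)
    open Transport {G = B} {H = graph} (fromWitness ∘ bipartite _ _) D≤w using (transport; weight-transport)

    realizesGraph : Realizes graph F
    realizesGraph a b a≢b =
      let m , _ , m≡D = realizes a b a≢b
          q = transport m
          q≤D = ≤-trans (weight-transport (proj₁ m)) (≤-reflexive m≡D)
      in q , (λ r → ≤-trans q≤D (D≤weight a≢b (proj₁ r))) , ≤-antisym q≤D (D≤weight a≢b (proj₁ q))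

    crossing⇒indecomposable : ∀ {a b} → Crossing a b → Indecomposable F a b
    crossing⇒indecomposable {a} {b} (inj₁ (a∈X , b∈Y)) = indec a b a∈X b∈Y
    crossing⇒indecomposable {a} {b} (inj₂ (a∈Y , b∈X)) = indecomposable-sym F (indec b a b∈X a∈Y)

    pruned : Pruned graph
    pruned a b e = indecomposable⇒useful e refl (crossing⇒indecomposable (toWitness e))

mainTheorem11 : (R : RealField) (n : ℕ) (F : Graphs.Family R n) (X Y : Subset n) →
    Graphs.Bigraphlike R F X Y →
    (Graphs.CoBigraphlike R F X Y ⇔
      (∀ i j → i ∈ X → j ∈ Y → Graphs.Indecomposable R F i j))
mainTheorem11 R n F X Y bigraphlike =
  mk⇔ (coBigraphlike⇒indecomposable {F = F} {X} {Y}) (indecomposable⇒coBigraphlike {F = F} {X} {Y} bigraphlike)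
  where open ShortestPathMetrics R
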